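{- Let $G$ be a graph, $T \subseteq V(G)$, and let $S \subseteq V(G)\setminus T$ be non-empty. The following are equivalent: (1) for each pair of distinct terminals $t_i,t_j \in T$, the graph $G-S$ does not contain $t_i$-$t_j$ paths $P_1,P_2$ which are internally vertex-disjoint (where $P_1$ may equal $P_2$ if it has no internal vertices); (2) for each pair of distinct terminals $t_i,t_j \in T$, there is a vertex $v \in V(G)\setminus T$ such that $t_i$ and $t_j$ belong to different connected components of $G-(S\cup\{v\})$; (3) $T$ is an independent set in $G$ and $G-S$ contains no simple cycle containing at least two vertices of $T$.
   Context: All graphs are finite, simple and undirected. -}

module Defs where

open import Data.Nat using (ℕ; _≤_)
open import Data.Bool using (Bool; true; false)
open import Data.Fin using (Fin)
open import Data.Fin.Subset using (Subset; _∈_; _∉_; _∪_; ⁅_⁆; Nonempty)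
open import Data.List using (List; []; _∷_; _++_; [_]; length)
open import Data.List.Relation.Unary.All using (All)
open import Data.List.Relation.Unary.Linked using (Linked)
open import Data.List.Relation.Unary.Unique.Propositional using (Unique)
open import Data.List.Relation.Unary.Any using (Any)
open import Data.Product using (Σ; ∃; _×_)
open import Relation.Binary.PropositionalEquality using (_≡_; _≢_)
open import Relation.Nullary using (¬_)

record Graph (n : ℕ) : Set where
  field
    adj   : Fin n → Fin n → Bool
    sym   : ∀ x y → adj x y ≡ adj y x
    irrefl : ∀ x → adj x x ≡ false

module _ {n : ℕ} (G : Graph n) where
  open Graph G

  E : Fin n → Fin n → Set
  E x y = adj x y ≡ true

  pathVerts : Fin n → List (Fin n) → Fin n → List (Fin n)
  pathVerts x is y = x ∷ (is ++ [ y ])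

  -- is is the internal vertex sequence of an x-y path in G - X
  IsPathIn : Subset n → Fin n → Fin n → List (Fin n) → Set
  IsPathIn X x y is =
    Linked E (pathVerts x is y) × Unique (pathVerts x is y) × All (_∉ X) (pathVerts x is y)

  Disjoint : List (Fin n) → List (Fin n) → Set
  Disjoint as bs = ∀ {v} → Any (v ≡_) as → ¬ Any (v ≡_) bs

  TwoInternallyDisjointPaths : Subset n → Fin n → Fin n → Set
  TwoInternallyDisjointPaths X x y =
    Σ (List (Fin n)) λ is₁ → Σ (List (Fin n)) λ is₂ →
      IsPathIn X x y is₁ × IsPathIn X x y is₂ × Disjoint is₁ is₂

  data Reachable (X : Subset n) : Fin n → Fin n → Set where
    here : ∀ {a} → a ∉ X → Reachable X a a
    step : ∀ {a c b} → a ∉ X → E a c → Reachable X c b → Reachable X a b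

  Independent : Subset n → Set
  Independent T = ∀ a b → a ∈ T → b ∈ T → adj a b ≡ false

  -- x ∷ rest is a simple cycle of G - X (length ≥ 3, closing edge from last to x)
  IsCycleIn : Subset n → Fin n → List (Fin n) → Set
  IsCycleIn X x rest =
    2 ≤ length rest × Unique (x ∷ rest) × Linked E (x ∷ (rest ++ [ x ])) × All (_∉ X) (x ∷ rest)

  HasCycleThroughTwo : Subset n → Subset n → Set
  HasCycleThroughTwo X T =
    Σ (Fin n) λ x → Σ (List (Fin n)) λ rest → IsCycleIn X x rest ×
      Σ (Fin n) λ a → Σ (Fin n) λ b → a ≢ b × a ∈ T × b ∈ T ×
        Any (a ≡_) (x ∷ rest) × Any (b ≡_) (x ∷ rest)

  Cond1 : Subset n → Subset n → Set
  Cond1 S T = ∀ ti tj → ti ∈ T → tj ∈ T → ti ≢ tj → ¬ TwoInternallyDisjointPaths S ti tj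

  Cond2 : Subset n → Subset n → Set
  Cond2 S T = ∀ ti tj → ti ∈ T → tj ∈ T → ti ≢ tj →
    ∃ λ v → v ∉ T × ¬ Reachable (S ∪ ⁅ v ⁆) ti tj

  Cond3 : Subset n → Subset n → Set
  Cond3 S T = Independent T × ¬ HasCycleThroughTwo S T

module Submission where

-- (2) ⇒ (1) and (2) ⇒ (3): two internally disjoint paths between terminals, or a cycle
-- through both, keep them connected after deleting any single other vertex, so no vertex
-- outside T separates them; an edge between terminals already is such a pair of paths.
-- (3) ⇒ (1): two such paths close up into a cycle through both terminals, unless one of
-- them is an edge, which independence rules out.
-- (1) ⇒ (2) is a local Menger argument along a path v w … u to a terminal u. If no vertex
-- outside T separates v from u, the same holds for w, so by induction w and u are joined
-- by internally disjoint paths A and B; by (1) w is not a terminal. A v–u walk avoiding w,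
-- followed up to its first vertex on A or B and then along that path, together with the
-- walk v w B (or v w A) gives two internally disjoint v–u walks, which shorten to paths.
-- Reachability is decidable, so if no vertex separates ti from tj this applies to v = ti.

open import Defs
open import Data.Nat using (ℕ; zero; suc; _≤_; z≤n; s≤s)
open import Data.Nat.Properties using (<⇒≤)
open import Data.Bool using (true; false)
open import Data.Bool.Properties using () renaming (_≟_ to _≟ᵇ_)
open import Data.Empty using (⊥-elim)
open import Data.Fin using (Fin; zero; suc)
open import Data.Fin.Properties using (_≟_; any?; injective⇒≤)
open import Data.Fin.Subset using (Subset; _∈_; _∉_; _∪_; ⁅_⁆; Nonempty)
open import Data.Fin.Subset.Properties using (_∈?_; x∈p∪q⁺; x∈p∪q⁻; x∈⁅x⁆; x∈⁅y⁆⇒x≡y)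
open import Data.List using (List; []; _∷_; _++_; [_]; length; lookup; reverse)
open import Data.List.Properties using (++-assoc; length-++-sucʳ; reverse-++; unfold-reverse)
open import Data.List.Membership.Propositional using () renaming (_∈_ to _∈ₗ_; _∉_ to _∉ₗ_)
open import Data.List.Membership.Propositional.Properties
  using (∈-++⁺ˡ; ∈-++⁺ʳ; ∈-++⁻; ∈-∃++; ∈-lookup)
open import Data.List.Relation.Binary.Subset.Propositional using (_⊆_)
open import Data.List.Relation.Binary.Subset.Propositional.Properties using (∷⁺ʳ)
open import Data.List.Relation.Binary.Permutation.Propositional using (↭-sym; ↭⇒↭ₛ)
open import Data.List.Relation.Binary.Permutation.Propositional.Properties using (↭-reverse)
import Data.List.Relation.Binary.Permutation.Setoid.Properties as Permutationₛ
open import Data.List.Relation.Unary.All as All using (All; []; _∷_)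
import Data.List.Relation.Unary.All.Properties as AllP
import Data.List.Relation.Unary.AllPairs as AllPairs
open import Data.List.Relation.Unary.Any using (here; there)
open import Data.List.Relation.Unary.Any.Properties using (++-comm; reverse⁻)
open import Data.List.Relation.Unary.First using (first; FirstView)
open import Data.List.Relation.Unary.First.Properties using (toView)
open import Data.List.Relation.Unary.Linked using (Linked; [-]; _∷_)
open import Data.List.Relation.Unary.Unique.Propositional using (Unique; []; _∷_)
open import Data.List.Relation.Unary.Unique.Propositional.Properties
  using (Unique[x∷xs]⇒x∉xs) renaming (++⁺ to Unique-++⁺)
open import Data.Product using (Σ; ∃; _×_; _,_; proj₁; proj₂)
import Data.Product as Product
open import Data.Sum using (inj₁; inj₂; swap)
open import Function using (_∘_)
open import Function.Bundles using (_⇔_; mk⇔)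
open import Function.Definitions using (Injective)
open import Relation.Binary.PropositionalEquality
  using (_≡_; _≢_; refl; sym; trans; cong; subst; setoid)
open import Relation.Nullary using (¬_; Dec; yes; no)
open import Relation.Nullary.Decidable using (_×-dec_; _⊎-dec_; ¬?; toSum; map′; decidable-stable)

module _ {ℓ} {A : Set ℓ} where

  lookup-injective : {xs : List A} → Unique xs → Injective _≡_ _≡_ (lookup xs)
  lookup-injective {_ ∷ _} _ {zero} {zero} _ = refl
  lookup-injective (x∉ ∷ _) {zero} {suc j} eq = ⊥-elim (All.lookup x∉ (∈-lookup j) eq)
  lookup-injective (x∉ ∷ _) {suc i} {zero} eq = ⊥-elim (All.lookup x∉ (∈-lookup i) (sym eq))
  lookup-injective (_ ∷ u) {suc i} {suc j} eq = cong suc (lookup-injective u eq)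

  Unique-middle∉ : ∀ xs {v : A} {ys} → Unique (xs ++ v ∷ ys) → v ∉ₗ xs ++ ys
  Unique-middle∉ [] (v∉ ∷ _) m = All.lookup v∉ m refl
  Unique-middle∉ (x ∷ xs) (x∉ ∷ _) (here refl) = All.lookup x∉ (∈-++⁺ʳ xs (here refl)) refl
  Unique-middle∉ (x ∷ xs) (_ ∷ u) (there m) = Unique-middle∉ xs u m

  Unique-reverse : {xs : List A} → Unique xs → Unique (reverse xs)
  Unique-reverse {xs} = Permutationₛ.Unique-resp-↭ (setoid A) (↭⇒↭ₛ (↭-sym (↭-reverse xs)))

  ∈-++-∷⁻ : ∀ xs {c v : A} {ys} → c ∈ₗ xs ++ v ∷ ys → v ≢ c → c ∈ₗ xs ++ ys
  ∈-++-∷⁻ xs c∈ v≢c with ∈-++⁻ xs c∈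
  ... | inj₁ c∈xs = ∈-++⁺ˡ c∈xs
  ... | inj₂ (here c≡v) = ⊥-elim (v≢c (sym c≡v))
  ... | inj₂ (there c∈ys) = ∈-++⁺ʳ xs c∈ys

module _ {n : ℕ} where

  unique-length≤ : {xs : List (Fin n)} → Unique xs → length xs ≤ n
  unique-length≤ u = injective⇒≤ (lookup-injective u)

  ∉∪⁅⁆ : {X : Subset n} {x v : Fin n} → x ∉ X → v ≢ x → x ∉ X ∪ ⁅ v ⁆
  ∉∪⁅⁆ {X} {v = v} x∉X v≢x x∈ with x∈p∪q⁻ X ⁅ v ⁆ x∈
  ... | inj₁ x∈X = x∉X x∈X
  ... | inj₂ x∈⁅v⁆ = v≢x (sym (x∈⁅y⁆⇒x≡y v x∈⁅v⁆))

  ∉∪⁅⁆⁻ : {X : Subset n} {x v : Fin n} → x ∉ X ∪ ⁅ v ⁆ → x ∉ X × v ≢ x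
  ∉∪⁅⁆⁻ x∉ = x∉ ∘ x∈p∪q⁺ ∘ inj₁ , λ { refl → x∉ (x∈p∪q⁺ (inj₂ (x∈⁅x⁆ _))) }

  ∉∧∈⇒≢ : {T : Subset n} {x y : Fin n} → x ∉ T → y ∈ T → x ≢ y
  ∉∧∈⇒≢ x∉T y∈T refl = x∉T y∈T

module _ {n : ℕ} (G : Graph n) where

  open Graph G using (adj; irrefl)
  open import Data.List.Membership.DecPropositional (_≟_ {n}) using () renaming (_∈?_ to _∈ₗ?_)

  private
    variable
      X Y T : Subset n
      a b c u v w x y z : Fin n
      is js q : List (Fin n)

  E-sym : E G x y → E G y x
  E-sym {x} {y} e = trans (Graph.sym G y x) e

  reachable-start∉ : Reachable G X x y → x ∉ X
  reachable-start∉ (here x∉) = x∉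
  reachable-start∉ (step x∉ _ _) = x∉

  reachable-trans : Reachable G X x y → Reachable G X y z → Reachable G X x z
  reachable-trans (here _) r = r
  reachable-trans (step x∉ e r) r′ = step x∉ e (reachable-trans r r′)

  reachable-sym : Reachable G X x y → Reachable G X y x
  reachable-sym (here x∉) = here x∉
  reachable-sym (step x∉ e r) =
    reachable-trans (reachable-sym r) (step (reachable-start∉ r) (E-sym e) (here x∉))

  reachable-via : Reachable G X z a → Reachable G X z b → Reachable G X a b
  reachable-via r₁ r₂ = reachable-trans (reachable-sym r₁) r₂

  reachable-weaken : (∀ {z} → z ∉ Y → z ∉ X) → Reachable G Y x y → Reachable G X x y
  reachable-weaken f (here x∉) = here (f x∉)
  reachable-weaken f (step x∉ e r) = step (f x∉) e (reachable-weaken f r)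

  data Walk (X : Subset n) : Fin n → List (Fin n) → Fin n → Set where
    edge : x ∉ X → E G x y → y ∉ X → Walk X x [] y
    step : x ∉ X → E G x z → Walk X z is y → Walk X x (z ∷ is) y

  walk-start∉ : Walk X x is y → x ∉ X
  walk-start∉ (edge x∉ _ _) = x∉
  walk-start∉ (step x∉ _ _) = x∉

  walk⇒linked : Walk X x is y →
                Linked (E G) (pathVerts G x is y) × All (_∉ X) (pathVerts G x is y)
  walk⇒linked (edge x∉ e y∉) = e ∷ [-] , x∉ ∷ y∉ ∷ []
  walk⇒linked (step x∉ e w) = let l , a = walk⇒linked w in e ∷ l , x∉ ∷ a

  linked⇒walk : ∀ is → Linked (E G) (pathVerts G x is y) → All (_∉ X) (pathVerts G x is y) →
                Walk X x is y
  linked⇒walk [] (e ∷ [-]) (x∉ ∷ y∉ ∷ []) = edge x∉ e y∉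
  linked⇒walk (_ ∷ is) (e ∷ l) (x∉ ∷ a) = step x∉ e (linked⇒walk is l a)

  walk-avoiding : v ≢ x → v ∉ₗ is → v ≢ y → Walk X x is y → Walk (X ∪ ⁅ v ⁆) x is y
  walk-avoiding v≢x _ v≢y (edge x∉ e y∉) = edge (∉∪⁅⁆ x∉ v≢x) e (∉∪⁅⁆ y∉ v≢y)
  walk-avoiding v≢x v∉ v≢y (step x∉ e w) =
    step (∉∪⁅⁆ x∉ v≢x) e (walk-avoiding (v∉ ∘ here) (v∉ ∘ there) v≢y w)

  walk-avoiding⁻ : Walk (X ∪ ⁅ v ⁆) x is y → Walk X x is y × v ∉ₗ is
  walk-avoiding⁻ (edge x∉ e y∉) = edge (proj₁ (∉∪⁅⁆⁻ x∉)) e (proj₁ (∉∪⁅⁆⁻ y∉)) , λ ()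
  walk-avoiding⁻ (step x∉ e w) with walk-avoiding⁻ w
  ... | w′ , v∉ = step (proj₁ (∉∪⁅⁆⁻ x∉)) e w′ , λ
    { (here refl) → proj₂ (∉∪⁅⁆⁻ (walk-start∉ w)) refl
    ; (there m) → v∉ m
    }

  _++ʷ_ : Walk X x is z → Walk X z js y → Walk X x (is ++ z ∷ js) y
  edge x∉ e _ ++ʷ w′ = step x∉ e w′
  step x∉ e w ++ʷ w′ = step x∉ e (w ++ʷ w′)

  walk-split : ∀ is {js} → Walk X x (is ++ z ∷ js) y → Walk X x is z × Walk X z js y
  walk-split [] (step x∉ e w) = edge x∉ e (walk-start∉ w) , w
  walk-split (_ ∷ is) (step x∉ e w) = Product.map₁ (step x∉ e) (walk-split is w)

  walk-reverse : Walk X x is y → Walk X y (reverse is) x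
  walk-reverse (edge x∉ e y∉) = edge y∉ (E-sym e) x∉
  walk-reverse {X} {x} (step {z = z} {is} x∉ e w) =
    subst (λ js → Walk X _ js x) (sym (unfold-reverse z is))
      (walk-reverse w ++ʷ edge (walk-start∉ w) (E-sym e) x∉)

  walk⇒reachable : Walk X x is y → Reachable G X x y
  walk⇒reachable (edge x∉ e y∉) = step x∉ e (here y∉)
  walk⇒reachable (step x∉ e w) = step x∉ e (walk⇒reachable w)

  reachable⇒walk : Reachable G X x y → x ≢ y → ∃ λ is → Walk X x is y
  reachable⇒walk (here _) x≢y = ⊥-elim (x≢y refl)
  reachable⇒walk {y = y} (step {c = c} x∉ e r) _ with c ≟ y
  ... | yes refl = [] , edge x∉ e (reachable-start∉ r)
  ... | no c≢y = Product.map (c ∷_) (step x∉ e) (reachable⇒walk r c≢y)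

  reachable-along : Walk X x is y → v ∉ₗ x ∷ is → c ∈ₗ x ∷ is → Reachable G (X ∪ ⁅ v ⁆) x c
  reachable-along w v∉ (here refl) = here (∉∪⁅⁆ (walk-start∉ w) (v∉ ∘ here))
  reachable-along (edge _ _ _) _ (there ())
  reachable-along (step x∉ e w) v∉ (there c∈) =
    step (∉∪⁅⁆ x∉ (v∉ ∘ here)) e (reachable-along w (v∉ ∘ there) c∈)

  edge-path : x ∉ X → E G x y → y ∉ X → x ≢ y → IsPathIn G X x y []
  edge-path x∉ e y∉ x≢y = e ∷ [-] , (x≢y ∷ []) ∷ [] ∷ [] , x∉ ∷ y∉ ∷ []

  path⇒walk : IsPathIn G X x y is → Walk X x is y
  path⇒walk (l , _ , a) = linked⇒walk _ l a

  path-tail : IsPathIn G X x y (z ∷ is) → IsPathIn G X z y is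
  path-tail (_ ∷ l , _ ∷ u , _ ∷ a) = l , u , a

  path-start∉ : IsPathIn G X x y is → x ∉ₗ is
  path-start∉ (_ , x∉ ∷ _ , _) m = All.lookup x∉ (∈-++⁺ˡ m) refl

  path-ends-distinct : IsPathIn G X x y is → x ≢ y
  path-ends-distinct {is = is} (_ , x∉ ∷ _ , _) = All.lookup x∉ (∈-++⁺ʳ is (here refl))

  path-suffix : IsPathIn G X z y js → x ∈ₗ z ∷ js → ∃ λ is → is ⊆ js × IsPathIn G X x y is
  path-suffix p (here refl) = _ , (λ m → m) , p
  path-suffix {js = _ ∷ _} p (there x∈) with path-suffix (path-tail p) x∈
  ... | is , is⊆ , p′ = is , there ∘ is⊆ , p′

  path-cons : x ∉ X → E G x z → x ∉ₗ z ∷ js → x ≢ y → IsPathIn G X z y js →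
              IsPathIn G X x y (z ∷ js)
  path-cons {z = z} {js = js} x∉X e x∉js x≢y (l , u , a) = e ∷ l , AllP.¬Any⇒All¬ _ x∉ ∷ u , x∉X ∷ a
    where
    x∉ : _ ∉ₗ (z ∷ js) ++ [ _ ]
    x∉ m with ∈-++⁻ (z ∷ js) m
    ... | inj₁ x∈js = x∉js x∈js
    ... | inj₂ (here x≡y) = x≢y x≡y

  loop-erase : Walk X x is y → x ≢ y → ∃ λ js → js ⊆ is × IsPathIn G X x y js
  loop-erase (edge x∉ e y∉) x≢y = [] , (λ ()) , edge-path x∉ e y∉ x≢y
  loop-erase {x = x} {y = y} (step {z = z} x∉ e w) x≢y with z ≟ y
  ... | yes refl = [] , (λ ()) , edge-path x∉ e (walk-start∉ w) x≢y
  ... | no z≢y with loop-erase w z≢y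
  ...   | js , js⊆ , p with x ∈ₗ? z ∷ js
  ...     | no x∉js = z ∷ js , ∷⁺ʳ z js⊆ , path-cons x∉ e x∉js x≢y p
  ...     | yes x∈ with path-suffix p x∈
  ...       | post , post⊆ , p′ = post , there ∘ js⊆ ∘ post⊆ , p′

  reachable⇒path : Reachable G X x y → x ≢ y → ∃ λ is → IsPathIn G X x y is
  reachable⇒path r x≢y with reachable⇒walk r x≢y
  ... | _ , w with loop-erase w x≢y
  ...   | js , _ , p = js , p

  data ReachableWithin (X : Subset n) : ℕ → Fin n → Fin n → Set where
    here : ∀ {k} → a ∉ X → ReachableWithin X k a a
    step : ∀ {k} → a ∉ X → E G a c → ReachableWithin X k c b → ReachableWithin X (suc k) a b

  within-start∉ : ∀ {k} → ReachableWithin X k x y → x ∉ X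
  within-start∉ (here x∉) = x∉
  within-start∉ (step x∉ _ _) = x∉

  within⇒reachable : ∀ {k} → ReachableWithin X k x y → Reachable G X x y
  within⇒reachable (here x∉) = here x∉
  within⇒reachable (step x∉ e r) = step x∉ e (within⇒reachable r)

  walk⇒within : ∀ {k} → Walk X x is y → length (is ++ [ y ]) ≤ k → ReachableWithin X k x y
  walk⇒within (edge x∉ e y∉) (s≤s _) = step x∉ e (here y∉)
  walk⇒within (step x∉ e w) (s≤s le) = step x∉ e (walk⇒within w le)

  reachable⇒within : Reachable G X x y → ReachableWithin X n x y
  reachable⇒within {x = x} {y = y} r with x ≟ y
  ... | yes refl = here (reachable-start∉ r)
  ... | no x≢y with reachable⇒path r x≢y
  ...   | _ , p@(_ , u , _) = walk⇒within (path⇒walk p) (<⇒≤ (unique-length≤ u))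

  reachableWithin? : ∀ X k a b → Dec (ReachableWithin X k a b)
  reachableWithin? X k a b with a ∈? X
  ... | yes a∈X = no λ r → within-start∉ r a∈X
  ... | no a∉X with a ≟ b
  ...   | yes refl = yes (here a∉X)
  reachableWithin? X zero a b | no _ | no a≢b = no λ { (here _) → a≢b refl }
  reachableWithin? X (suc k) a b | no a∉X | no a≢b
    with any? (λ c → (adj a c ≟ᵇ true) ×-dec reachableWithin? X k c b)
  ... | yes (_ , e , r) = yes (step a∉X e r)
  ... | no ¬next = no λ { (here _) → a≢b refl ; (step _ e r) → ¬next (_ , e , r) }

  reachable? : ∀ X a b → Dec (Reachable G X a b)
  reachable? X a b = map′ within⇒reachable reachable⇒within (reachableWithin? X n a b)

  Inseparable : Subset n → Subset n → Fin n → Fin n → Set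
  Inseparable X T a b = ∀ z → z ∉ T → z ≢ a → z ≢ b → Reachable G (X ∪ ⁅ z ⁆) a b

  twoDisjointPaths⇒inseparable : TwoInternallyDisjointPaths G X a b → Inseparable X T a b
  twoDisjointPaths⇒inseparable (is₁ , _ , p₁ , p₂ , d) z _ z≢a z≢b with z ∈ₗ? is₁
  ... | yes z∈ = walk⇒reachable (walk-avoiding z≢a (d z∈) z≢b (path⇒walk p₂))
  ... | no z∉ = walk⇒reachable (walk-avoiding z≢a z∉ z≢b (path⇒walk p₁))

  cycle⇒closedWalk : IsCycleIn G X x is → Walk X x is x
  cycle⇒closedWalk (_ , _ , l , a) = linked⇒walk _ l (AllP.++⁺ a (All.head a ∷ []))

  closedWalk-rotate : ∀ pre {post} → Walk X x (pre ++ v ∷ post) x → Walk X v (post ++ x ∷ pre) v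
  closedWalk-rotate pre w = let w₁ , w₂ = walk-split pre w in w₂ ++ʷ w₁

  walk-internal-connected : Walk X x is y → v ∉ₗ is → a ∈ₗ is → b ∈ₗ is →
                            Reachable G (X ∪ ⁅ v ⁆) a b
  walk-internal-connected (step _ _ w) v∉ a∈ b∈ =
    reachable-via (reachable-along w v∉ a∈) (reachable-along w v∉ b∈)

  cycle⇒inseparable : IsCycleIn G X x is → a ∈ₗ x ∷ is → b ∈ₗ x ∷ is → Inseparable X T a b
  cycle⇒inseparable {X = X} {x = x} {is} cyc@(_ , u , _) a∈ b∈ z _ z≢a z≢b with z ∈ₗ? x ∷ is
  ... | no z∉ = reachable-via (along a∈) (along b∈)
    where
    along : c ∈ₗ x ∷ is → Reachable G (X ∪ ⁅ z ⁆) x c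
    along = reachable-along (cycle⇒closedWalk cyc) z∉
  ... | yes (here refl) =
    walk-internal-connected (cycle⇒closedWalk cyc) (Unique[x∷xs]⇒x∉xs u)
      (∈-++-∷⁻ [] a∈ z≢a) (∈-++-∷⁻ [] b∈ z≢b)
  ... | yes (there z∈) with ∈-∃++ z∈
  ...   | pre , post , refl =
    walk-internal-connected (closedWalk-rotate pre (cycle⇒closedWalk cyc))
      (Unique-middle∉ (x ∷ pre) u ∘ ++-comm post (x ∷ pre)) (rotate a∈ z≢a) (rotate b∈ z≢b)
    where
    rotate : c ∈ₗ x ∷ pre ++ z ∷ post → z ≢ c → c ∈ₗ post ++ x ∷ pre
    rotate c∈ z≢c = ++-comm (x ∷ pre) post (∈-++-∷⁻ (x ∷ pre) c∈ z≢c)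

  twoDisjointPaths⇒cycle : IsPathIn G X x y (z ∷ is) → IsPathIn G X x y js →
                           Disjoint G (z ∷ is) js → IsCycleIn G X x (z ∷ is ++ y ∷ reverse js)
  twoDisjointPaths⇒cycle {X = X} {x = x} {y = y} {z = z} {is = is} {js = js}
                         p₁@(_ , u₁ , _) p₂@(_ , _ ∷ u₂ , _) d =
    length≥2 , unique , proj₁ (walk⇒linked closed) ,
    AllP.++⁻ˡ (x ∷ z ∷ is ++ y ∷ reverse js) (proj₂ (walk⇒linked closed))
    where
    closed : Walk X x (z ∷ is ++ y ∷ reverse js) x
    closed = path⇒walk {is = z ∷ is} p₁ ++ʷ walk-reverse (path⇒walk {is = js} p₂)
    length≥2 : 2 ≤ length (z ∷ is ++ y ∷ reverse js)
    length≥2 rewrite length-++-sucʳ is y (reverse js) = s≤s (s≤s z≤n)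
    y∷js′ : Unique (y ∷ reverse js)
    y∷js′ = subst Unique (reverse-++ js [ y ]) (Unique-reverse u₂)
    disjoint : ∀ {c} → ¬ (c ∈ₗ x ∷ (z ∷ is) ++ [ y ] × c ∈ₗ reverse js)
    disjoint (here refl , c∈) = path-start∉ p₂ (reverse⁻ c∈)
    disjoint (there c∈p , c∈) with ∈-++⁻ (z ∷ is) c∈p
    ... | inj₁ c∈is = d c∈is (reverse⁻ c∈)
    ... | inj₂ (here refl) = Unique[x∷xs]⇒x∉xs y∷js′ c∈
    unique : Unique (x ∷ z ∷ is ++ y ∷ reverse js)
    unique = subst (Unique ∘ (x ∷_)) (++-assoc (z ∷ is) [ y ] (reverse js))
      (Unique-++⁺ u₁ (AllPairs.tail y∷js′) disjoint)

  TwoInternallyDisjointWalks : Subset n → Fin n → Fin n → Set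
  TwoInternallyDisjointWalks X x y =
    Σ (List (Fin n)) λ is₁ → Σ (List (Fin n)) λ is₂ →
      Walk X x is₁ y × Walk X x is₂ y × Disjoint G is₁ is₂

  twoDisjointWalks⇒twoDisjointPaths : x ≢ y → TwoInternallyDisjointWalks X x y →
                                      TwoInternallyDisjointPaths G X x y
  twoDisjointWalks⇒twoDisjointPaths x≢y (_ , _ , w₁ , w₂ , d)
    with loop-erase w₁ x≢y | loop-erase w₂ x≢y
  ... | js₁ , js₁⊆ , p₁ | js₂ , js₂⊆ , p₂ = js₁ , js₂ , p₁ , p₂ , λ m₁ m₂ → d (js₁⊆ m₁) (js₂⊆ m₂)

  module _ {X : Subset n} (vw : E G v w) (v∉X : v ∉ X) where

    reroute : ∀ pre {post A B} → Walk X v (pre ++ x ∷ post) u → w ∉ₗ pre → All (_∉ₗ B) pre →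
              IsPathIn G X w u A → IsPathIn G X w u B → Disjoint G A B → x ∈ₗ A →
              TwoInternallyDisjointWalks X v u
    reroute pre {A = A} {B} Q w∉pre pre∩B=∅ pA pB A∩B=∅ x∈A with path-suffix pA (there x∈A)
    ... | A₂ , A₂⊆A , pA₂ =
      pre ++ _ ∷ A₂ , w ∷ B ,
      proj₁ (walk-split pre Q) ++ʷ path⇒walk pA₂ , step v∉X vw (path⇒walk pB) ,
      disjoint
      where
      A-avoids : c ∈ₗ A → c ∉ₗ w ∷ B
      A-avoids c∈A (here refl) = path-start∉ pA c∈A
      A-avoids c∈A (there c∈B) = A∩B=∅ c∈A c∈B
      disjoint : Disjoint G (pre ++ _ ∷ A₂) (w ∷ B)
      disjoint c∈ with ∈-++⁻ pre c∈
      ... | inj₁ c∈pre = λ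
        { (here refl) → w∉pre c∈pre
        ; (there c∈B) → All.lookup pre∩B=∅ c∈pre c∈B
        }
      ... | inj₂ (here refl) = A-avoids x∈A
      ... | inj₂ (there c∈A₂) = A-avoids (A₂⊆A c∈A₂)

    twoDisjointWalks-extend : Walk (X ∪ ⁅ w ⁆) v q u → TwoInternallyDisjointPaths G X w u →
                              TwoInternallyDisjointWalks X v u
    twoDisjointWalks-extend {q} Q-avoiding-w (A , B , pA , pB , A∩B=∅)
      with walk-avoiding⁻ Q-avoiding-w
    ... | Q , w∉q with first (λ y → swap (toSum ((y ∈ₗ? A) ⊎-dec (y ∈ₗ? B)))) q
    ...   | inj₂ miss = q , w ∷ B , Q , step v∉X vw (path⇒walk pB) , λ c∈q → λ
      { (here refl) → w∉q c∈q
      ; (there c∈B) → All.lookup miss c∈q (inj₂ c∈B)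
      }
    ...   | inj₁ hit with toView hit
    ...     | FirstView._++_∷_ {pre} miss (inj₁ x∈A) _ =
      reroute pre Q (w∉q ∘ ∈-++⁺ˡ) (All.map (_∘ inj₂) miss) pA pB A∩B=∅ x∈A
    ...     | FirstView._++_∷_ {pre} miss (inj₂ x∈B) _ =
      reroute pre Q (w∉q ∘ ∈-++⁺ˡ) (All.map (_∘ inj₁) miss) pB pA (λ b a → A∩B=∅ a b) x∈B

  inseparable-step : IsPathIn G X v u (w ∷ is) → Inseparable X T v u → Inseparable X T w u
  inseparable-step {v = v} p@(vw ∷ _ , _ , _ ∷ w∉X ∷ _) insep z z∉T z≢w z≢u with z ≟ v
  ... | yes refl =
    walk⇒reachable (walk-avoiding z≢w (path-start∉ p ∘ there) z≢u (path⇒walk (path-tail p)))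
  ... | no z≢v = step (∉∪⁅⁆ w∉X z≢w) (E-sym vw) (insep z z∉T z≢v z≢u)

  module _ {S T : Subset n} (c1 : Cond1 G S T) (u∈T : u ∈ T) where

    inseparable⇒twoDisjointPaths : IsPathIn G S v u is → Inseparable S T v u →
                                   TwoInternallyDisjointPaths G S v u
    inseparable⇒twoDisjointPaths {is = []} p _ = [] , [] , p , p , λ ()
    inseparable⇒twoDisjointPaths {v = v} {is = w ∷ is} p@(vw ∷ _ , _ , v∉S ∷ _) insep
      with path-tail {is = is} p
    ... | p′ with w ∈? T | inseparable⇒twoDisjointPaths p′ (inseparable-step p insep)
    ...   | yes w∈T | two = ⊥-elim (c1 w u w∈T u∈T (path-ends-distinct p′) two)
    ...   | no w∉T | two =
      twoDisjointWalks⇒twoDisjointPaths v≢u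
        (twoDisjointWalks-extend vw v∉S (proj₂ (reachable⇒walk connected-without-w v≢u)) two)
      where
      v≢u : v ≢ u
      v≢u = path-ends-distinct {is = w ∷ is} p
      connected-without-w : Reachable G (S ∪ ⁅ w ⁆) v u
      connected-without-w =
        insep w w∉T (path-start∉ {is = w ∷ is} p ∘ here ∘ sym) (path-ends-distinct p′)

  module _ {S T : Subset n} where

    cond2⇒separated : Cond2 G S T → a ∈ T → b ∈ T → a ≢ b → ¬ Inseparable S T a b
    cond2⇒separated c2 a∈T b∈T a≢b insep with c2 _ _ a∈T b∈T a≢b
    ... | v , v∉T , ¬connected = ¬connected (insep v v∉T (∉∧∈⇒≢ v∉T a∈T) (∉∧∈⇒≢ v∉T b∈T))

    cond2⇒cond1 : Cond2 G S T → Cond1 G S T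
    cond2⇒cond1 c2 _ _ ti∈T tj∈T ti≢tj two =
      cond2⇒separated c2 ti∈T tj∈T ti≢tj (twoDisjointPaths⇒inseparable two)

    cond1⇒independent : (∀ x → x ∈ S → x ∉ T) → Cond1 G S T → Independent G T
    cond1⇒independent S∩T=∅ c1 a b a∈T b∈T with adj a b in e
    ... | false = refl
    ... | true = ⊥-elim (c1 a b a∈T b∈T a≢b ([] , [] , p , p , λ ()))
      where
      a≢b : a ≢ b
      a≢b refl with () ← trans (sym e) (irrefl a)
      p : IsPathIn G S a b []
      p = edge-path (λ a∈S → S∩T=∅ a a∈S a∈T) e (λ b∈S → S∩T=∅ b b∈S b∈T) a≢b

    cond2⇒cond3 : (∀ x → x ∈ S → x ∉ T) → Cond2 G S T → Cond3 G S T
    cond2⇒cond3 S∩T=∅ c2 = cond1⇒independent S∩T=∅ (cond2⇒cond1 c2) , no-cycle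
      where
      no-cycle : ¬ HasCycleThroughTwo G S T
      no-cycle (_ , _ , cyc , _ , _ , a≢b , a∈T , b∈T , a∈ , b∈) =
        cond2⇒separated c2 a∈T b∈T a≢b (cycle⇒inseparable cyc a∈ b∈)

    cond3⇒cond1 : Cond3 G S T → Cond1 G S T
    cond3⇒cond1 (indep , _) ti tj ti∈T tj∈T _ ([] , _ , (e ∷ _ , _) , _)
      with () ← trans (sym e) (indep ti tj ti∈T tj∈T)
    cond3⇒cond1 (_ , no-cycle) ti tj ti∈T tj∈T ti≢tj (z ∷ is , _ , p₁ , p₂ , d) =
      no-cycle (ti , _ , twoDisjointPaths⇒cycle p₁ p₂ d ,
                ti , tj , ti≢tj , ti∈T , tj∈T , here refl , there (∈-++⁺ʳ (z ∷ is) (here refl)))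

    cond1⇒cond2 : (∀ x → x ∈ S → x ∉ T) → Nonempty S → Cond1 G S T → Cond2 G S T
    cond1⇒cond2 S∩T=∅ (z₀ , z₀∈S) c1 ti tj ti∈T tj∈T ti≢tj
      with any? (λ v → ¬? (v ∈? T) ×-dec ¬? (reachable? (S ∪ ⁅ v ⁆) ti tj))
    ... | yes separator = separator
    ... | no ¬separator =
      ⊥-elim (c1 ti tj ti∈T tj∈T ti≢tj (inseparable⇒twoDisjointPaths c1 tj∈T (proj₂ path) insep))
      where
      insep : Inseparable S T ti tj
      insep z z∉T _ _ = decidable-stable (reachable? _ ti tj) λ ¬r → ¬separator (z , z∉T , ¬r)
      z₀∉T : z₀ ∉ T
      z₀∉T = S∩T=∅ z₀ z₀∈S
      -- Deleting z₀ ∈ S does not change G − S; this is the only use of S being nonempty.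
      path : ∃ λ is → IsPathIn G S ti tj is
      path = reachable⇒path
        (reachable-weaken (proj₁ ∘ ∉∪⁅⁆⁻) (insep z₀ z₀∉T (∉∧∈⇒≢ z₀∉T ti∈T) (∉∧∈⇒≢ z₀∉T tj∈T))) ti≢tj

proposition2p5 : {n : ℕ} (G : Graph n) (T S : Subset n) →
    (∀ x → x ∈ S → x ∉ T) → Nonempty S →
    (Cond1 G S T ⇔ Cond2 G S T) × (Cond2 G S T ⇔ Cond3 G S T)
proposition2p5 G T S S∩T=∅ S≠∅ =
  mk⇔ (cond1⇒cond2 G S∩T=∅ S≠∅) (cond2⇒cond1 G) ,
  mk⇔ (cond2⇒cond3 G S∩T=∅) (cond1⇒cond2 G S∩T=∅ S≠∅ ∘ cond3⇒cond1 G)
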